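{- Let $(G,k)$ be an instance of PITVD and let $x$ be a vertex of $G$ such that there are $\ell\ge 4$ distinct pendant trees $C_1,\dots,C_\ell$ attached to $x$. Let $Z=\bigcup_{j=4}^{\ell}C_j$. Then $(G,k)$ is a yes-instance of PITVD if and only if $(G-Z,k)$ is a yes-instance of PITVD.
   Context: PITVD: given an undirected (multi)graph $G$ without self-loops and an integer $k$, decide whether there is $X\subseteq V(G)$, $|X|\le k$, such that $G-X$ is a simple graph every connected component of which is a proper interval graph or a tree. For a cut vertex $x$ of $G$ and a connected component $C$ of $G-x$ that is a tree, $C$ is a \emph{pendant tree attached to $x$} if $G[C\cup\{x\}]$ is a tree. -}

module Defs where

open import Data.Nat using (ℕ; zero; suc; _≤_; _<_; _≤?_)
open import Data.Fin using (Fin; zero; suc; inject₁; fromℕ; toℕ)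
open import Data.Fin.Subset using (Subset; _∈_; _∉_; _⊆_; ⊤; ∁; ⁅_⁆; _∪_; _∩_; ⋃; ∣_∣)
open import Data.List using (List; map; filter; allFin)
open import Data.Product using (Σ; ∃; _×_; _,_)
open import Data.Sum using (_⊎_)
open import Relation.Nullary using (¬_)
open import Relation.Binary.PropositionalEquality using (_≡_; _≢_)
open import Function.Bundles using (_⇔_)
open import Function.Definitions using (Injective)

-- A finite undirected multigraph without self-loops on vertex set Fin n,
-- given by its (symmetric) edge-multiplicity function.
record Multigraph (n : ℕ) : Set where
  field
    mult     : Fin n → Fin n → ℕ
    sym      : ∀ u v → mult u v ≡ mult v u
    loopless : ∀ v → mult v v ≡ 0
open Multigraph public

module _ {n : ℕ} (G : Multigraph n) where

  Adj : Fin n → Fin n → Set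
  Adj u v = 0 < mult G u v

  Simple : Subset n → Set
  Simple S = ∀ u v → u ∈ S → v ∈ S → mult G u v ≤ 1

  data Reach (S : Subset n) (u : Fin n) : Fin n → Set where
    here : u ∈ S → Reach S u u
    step : ∀ {w v} → Reach S u w → Adj w v → v ∈ S → Reach S u v

  Connected : Subset n → Set
  Connected S = ∀ u v → u ∈ S → v ∈ S → Reach S u v

  -- A cycle of length r+3 in G[S]: distinct vertices c 0, …, c (r+2),
  -- consecutive ones adjacent and the last adjacent to the first.
  record Cycle (S : Subset n) : Set where
    field
      r      : ℕ
      c      : Fin (suc (suc (suc r))) → Fin n
      inS    : ∀ i → c i ∈ S
      inj    : Injective _≡_ _≡_ c
      consec : ∀ (i : Fin (suc (suc r))) → Adj (c (inject₁ i)) (c (suc i))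
      close  : Adj (c (fromℕ (suc (suc r)))) (c zero)

  IsTree : Subset n → Set
  IsTree S = Simple S × Connected S × ¬ Cycle S

  -- G[S] is a proper interval graph: it is the intersection graph of closed
  -- intervals [l v , r v] (integer endpoints) none of which properly
  -- contains another.
  ProperInterval : Subset n → Set
  ProperInterval S =
    Σ (Fin n → ℕ) λ l → Σ (Fin n → ℕ) λ r →
      (∀ v → v ∈ S → l v ≤ r v) ×
      (∀ u v → u ∈ S → v ∈ S → u ≢ v → (Adj u v ⇔ (l u ≤ r v × l v ≤ r u))) ×
      (∀ u v → u ∈ S → v ∈ S →
         ¬ (l u ≤ l v × r v ≤ r u × (l u < l v ⊎ r v < r u)))

  IsComponent : Subset n → Subset n → Set
  IsComponent S C = C ⊆ S × Σ (Fin n) λ v → v ∈ C × (∀ w → (w ∈ C ⇔ Reach S v w))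

  PITVDSolution : Subset n → ℕ → Subset n → Set
  PITVDSolution S k X =
    X ⊆ S × ∣ X ∣ ≤ k × Simple (S ∩ ∁ X) ×
    (∀ C → IsComponent (S ∩ ∁ X) C → ProperInterval C ⊎ IsTree C)

  YesInstance : Subset n → ℕ → Set
  YesInstance S k = Σ (Subset n) λ X → PITVDSolution S k X

  CutVertex : Fin n → Set
  CutVertex x = Σ (Fin n) λ u → Σ (Fin n) λ v →
    u ≢ x × v ≢ x × Reach ⊤ u v × ¬ Reach (∁ ⁅ x ⁆) u v

  PendantTree : Fin n → Subset n → Set
  PendantTree x C = CutVertex x × IsComponent (∁ ⁅ x ⁆) C × IsTree C × IsTree (C ∪ ⁅ x ⁆)

-- Z = C_4 ∪ … ∪ C_ℓ (0-indexed: indices j with toℕ j ≥ 3).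
tailUnion : {n ℓ : ℕ} → (Fin ℓ → Subset n) → Subset n
tailUnion {ℓ = ℓ} C = ⋃ (map C (filter (λ j → 3 ≤? toℕ j) (allFin ℓ)))

{-# OPTIONS --safe #-}
-- Solutions restrict to induced subgraphs, which gives one direction. Conversely, let X solve
-- G − Z. If x ∈ X, then X also solves G: a component of G − X meeting some C j lies inside
-- C j, and any other lies inside a component of (G − Z) − X. If x ∉ X and all neighbours of
-- x in one of C 0, C 1, C 2 lie in X, exchanging one of them for x gives a solution of the
-- same size containing x. Otherwise x has neighbours outside X in C 0, C 1 and C 2, which form
-- a claw with x; so the component D of x in (G − Z) − X is not a proper interval graph, hence
-- a tree. Gluing the trees C j (j ≥ 3) onto D at x leaves it a tree: a cycle minus x stays
-- connected in G − x, so the cycle lies either in a single C j ∪ {x} or entirely in D.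
module Submission where

open import Defs
open import Data.Bool using (Bool; T)
open import Data.Bool.Properties using (T-≡)
open import Data.Empty using (⊥; ⊥-elim)
open import Data.Fin as Fin using (Fin; zero; suc; inject₁; inject≤; fromℕ; toℕ; _≟_; #_)
import Data.Fin.Properties as Fin
open import Data.Fin.Induction using (<-weakInduction; >-weakInduction)
open import Data.Fin.Subset using (Subset; _∈_; _∉_; _⊆_; ⊤; ∁; ⁅_⁆; _∪_; _∩_; ⋃; ∣_∣; _-_; inside; outside)
open import Data.Fin.Subset.Properties
  using (_∈?_; ∉⊥; ⊆⊤; ∣p∣≤n; x∈⁅x⁆; x∈⁅y⁆⇒x≡y; x≢y⇒x∉⁅y⁆; x∈∁p⇒x∉p; x∉p⇒x∈∁p; p∩q⊆p; p∩q⊆q;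
         x∈p∩q⁺; x∈p∪q⁻; x∈p∪q⁺; p─q⊆p; x∈p∧x≢y⇒x∈p-y; x∈p⇒∣p-x∣<∣p∣; ∣p∩q∣≤∣p∣; ∣⁅x⁆∣≡1; ⊆-antisym)
import Data.List as List
open import Data.List using (List; map; filter; allFin)
open import Data.List.Membership.Propositional using () renaming (_∈_ to _∈ₗ_)
open import Data.List.Membership.Propositional.Properties using (∈-map⁻; ∈-map⁺; ∈-filter⁻; ∈-filter⁺; ∈-allFin)
import Data.List.Relation.Unary.Any as Any
open import Data.Nat using (ℕ; zero; suc; _≤_; _<_; _≤?_; _<?_; z≤n; s≤s; _+_)
import Data.Nat.Properties as ℕ
open import Data.Product using (∃; _×_; _,_; proj₁; proj₂)
open import Data.Sum using (_⊎_; inj₁; inj₂; [_,_])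
open import Data.Vec using ([]; _∷_; tabulate)
open import Data.Vec.Properties using (lookup∘tabulate; []=⇒lookup; lookup⇒[]=)
open import Function using (_∘_; id)
open import Function.Bundles using (_⇔_; mk⇔; Equivalence)
open import Function.Definitions using (Injective)
open import Relation.Nullary using (¬_; Dec; yes; no)
open import Relation.Nullary.Decidable using (map′; _×-dec_; ¬?; toWitness; fromWitness; isYes; decidable-stable)
open import Relation.Binary.PropositionalEquality as ≡ using (_≡_; _≢_; refl; cong; subst)

∣p∪q∣≤∣p∣+∣q∣ : ∀ {n} (p q : Subset n) → ∣ p ∪ q ∣ ≤ ∣ p ∣ + ∣ q ∣
∣p∪q∣≤∣p∣+∣q∣ []            []            = z≤n
∣p∪q∣≤∣p∣+∣q∣ (inside ∷ p)  (inside ∷ q)  = s≤s (ℕ.≤-trans (∣p∪q∣≤∣p∣+∣q∣ p q) (ℕ.+-monoʳ-≤ ∣ p ∣ (ℕ.n≤1+n ∣ q ∣)))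
∣p∪q∣≤∣p∣+∣q∣ (inside ∷ p)  (outside ∷ q) = s≤s (∣p∪q∣≤∣p∣+∣q∣ p q)
∣p∪q∣≤∣p∣+∣q∣ (outside ∷ p) (inside ∷ q)  = ℕ.≤-trans (s≤s (∣p∪q∣≤∣p∣+∣q∣ p q)) (ℕ.≤-reflexive (≡.sym (ℕ.+-suc ∣ p ∣ ∣ q ∣)))
∣p∪q∣≤∣p∣+∣q∣ (outside ∷ p) (outside ∷ q) = ∣p∪q∣≤∣p∣+∣q∣ p q

x≢y⇒x∈∁⁅y⁆ : ∀ {n} {x y : Fin n} → x ≢ y → x ∈ ∁ ⁅ y ⁆
x≢y⇒x∈∁⁅y⁆ = x∉p⇒x∈∁p ∘ x≢y⇒x∉⁅y⁆

∈-tabulate⇔ : ∀ {n} {f : Fin n → Bool} {w} → w ∈ tabulate f ⇔ T (f w)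
∈-tabulate⇔ {f = f} {w} = mk⇔
  (λ w∈ → Equivalence.from T-≡ (≡.trans (≡.sym (lookup∘tabulate f w)) ([]=⇒lookup w∈)))
  (λ t → lookup⇒[]= w _ (≡.trans (lookup∘tabulate f w) (Equivalence.to T-≡ t)))

∈⋃⁻ : ∀ {n} {v : Fin n} Ss → v ∈ ⋃ Ss → ∃ λ S → S ∈ₗ Ss × v ∈ S
∈⋃⁻ List.[]       v∈ = ⊥-elim (∉⊥ v∈)
∈⋃⁻ (S List.∷ Ss) v∈ with x∈p∪q⁻ S (⋃ Ss) v∈
... | inj₁ v∈S = S , Any.here refl , v∈S
... | inj₂ v∈⋃ with ∈⋃⁻ Ss v∈⋃
...   | S′ , S′∈Ss , v∈S′ = S′ , Any.there S′∈Ss , v∈S′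

∈⋃⁺ : ∀ {n} {v : Fin n} {S} Ss → S ∈ₗ Ss → v ∈ S → v ∈ ⋃ Ss
∈⋃⁺ (S List.∷ Ss) (Any.here refl)  v∈S = x∈p∪q⁺ (inj₁ v∈S)
∈⋃⁺ (S List.∷ Ss) (Any.there S∈Ss) v∈S = x∈p∪q⁺ (inj₂ (∈⋃⁺ Ss S∈Ss v∈S))

module _ {n ℓ : ℕ} (C : Fin ℓ → Subset n) where

  private
    tail : List (Fin ℓ)
    tail = filter (λ j → 3 ≤? toℕ j) (allFin ℓ)

  ∈tailUnion⁻ : ∀ {v} → v ∈ tailUnion C → ∃ λ j → 3 ≤ toℕ j × v ∈ C j
  ∈tailUnion⁻ v∈ with ∈⋃⁻ (map C tail) v∈
  ... | _ , S∈ , v∈S with ∈-map⁻ C S∈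
  ...   | j , j∈ , refl = j , proj₂ (∈-filter⁻ (λ j → 3 ≤? toℕ j) {xs = allFin ℓ} j∈) , v∈S

  ∈tailUnion⁺ : ∀ {v} j → 3 ≤ toℕ j → v ∈ C j → v ∈ tailUnion C
  ∈tailUnion⁺ j 3≤j v∈Cj =
    ∈⋃⁺ (map C tail) (∈-map⁺ C (∈-filter⁺ (λ j → 3 ≤? toℕ j) {xs = allFin ℓ} (∈-allFin j) 3≤j)) v∈Cj

module _ {n : ℕ} (G : Multigraph n) where

  Adj-sym : ∀ {u v} → Adj G u v → Adj G v u
  Adj-sym {u} {v} = subst (0 <_) (Multigraph.sym G u v)

  Adj-irrefl : ∀ {u} → ¬ Adj G u u
  Adj-irrefl {u} = ℕ.<-irrefl (≡.sym (loopless G u))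

  adj? : ∀ u v → Dec (Adj G u v)
  adj? u v = 0 <? mult G u v

  reach-source : ∀ {S u v} → Reach G S u v → u ∈ S
  reach-source (here u∈S)   = u∈S
  reach-source (step r _ _) = reach-source r

  reach-target : ∀ {S u v} → Reach G S u v → v ∈ S
  reach-target (here u∈S)     = u∈S
  reach-target (step _ _ v∈S) = v∈S

  reach-mono : ∀ {S T u v} → S ⊆ T → Reach G S u v → Reach G T u v
  reach-mono S⊆T (here u∈S)     = here (S⊆T u∈S)
  reach-mono S⊆T (step r a v∈S) = step (reach-mono S⊆T r) a (S⊆T v∈S)

  reach-within : ∀ {S T u v} → (∀ w → Reach G S u w → w ∈ T) → Reach G S u v → Reach G T u v
  reach-within {u = u} inT (here u∈S)             = here (inT u (here u∈S))
  reach-within         inT (step {v = v} r a v∈S) = step (reach-within inT r) a (inT v (step r a v∈S))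

  reach-cons : ∀ {S u w v} → u ∈ S → Adj G u w → Reach G S w v → Reach G S u v
  reach-cons u∈S uw (here w∈S)     = step (here u∈S) uw w∈S
  reach-cons u∈S uw (step r a v∈S) = step (reach-cons u∈S uw r) a v∈S

  reach-trans : ∀ {S u w v} → Reach G S u w → Reach G S w v → Reach G S u v
  reach-trans r (here _)         = r
  reach-trans r (step r′ a v∈S) = step (reach-trans r r′) a v∈S

  reach-sym : ∀ {S u v} → Reach G S u v → Reach G S v u
  reach-sym (here u∈S)     = here u∈S
  reach-sym (step r a v∈S) = reach-cons v∈S (Adj-sym a) (reach-sym r)

  reach-last-edge : ∀ {S u v} → Reach G S u v → u ≢ v → ∃ λ w → w ∈ S × Adj G w v
  reach-last-edge (here _)     u≢u = ⊥-elim (u≢u refl)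
  reach-last-edge (step r a _) _   = _ , reach-target r , a

  reach-uncons : ∀ {S u v} → Reach G S u v → u ≡ v ⊎ ∃ λ w → Adj G u w × Reach G (S - u) w v
  reach-uncons (here _) = inj₁ refl
  reach-uncons {u = u} (step {v = v} r a v∈S) with v ≟ u | reach-uncons r
  ... | yes refl | _                  = inj₁ refl
  ... | no v≢u   | inj₁ refl          = inj₂ (v , a , here (x∈p∧x≢y⇒x∈p-y v∈S v≢u))
  ... | no v≢u   | inj₂ (w , uw , r′) = inj₂ (w , uw , step r′ a (x∈p∧x≢y⇒x∈p-y v∈S v≢u))

  reach?′ : ∀ f S → ∣ S ∣ < f → ∀ u v → Dec (Reach G S u v)
  reach?′ (suc f) S (s≤s ∣S∣≤f) u v with u ∈? S | u ≟ v
  ... | no u∉S  | _        = no (u∉S ∘ reach-source)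
  ... | yes u∈S | yes refl = yes (here u∈S)
  ... | yes u∈S | no u≢v   =
    map′ (λ { (w , uw , r) → reach-cons u∈S uw (reach-mono (p─q⊆p S ⁅ u ⁆) r) })
         ([ ⊥-elim ∘ u≢v , id ] ∘ reach-uncons)
         (Fin.any? λ w → adj? u w ×-dec reach?′ f (S - u) (ℕ.<-≤-trans (x∈p⇒∣p-x∣<∣p∣ u∈S) ∣S∣≤f) w v)

  reach? : ∀ S u v → Dec (Reach G S u v)
  reach? S = reach?′ (suc n) S (s≤s (∣p∣≤n S))

  component : Subset n → Fin n → Subset n
  component S v = tabulate λ w → isYes (reach? S v w)

  ∈component⇔ : ∀ {S v w} → w ∈ component S v ⇔ Reach G S v w
  ∈component⇔ = mk⇔ (toWitness ∘ Equivalence.to ∈-tabulate⇔) (Equivalence.from ∈-tabulate⇔ ∘ fromWitness)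

  component-isComponent : ∀ {S v} → v ∈ S → IsComponent G S (component S v)
  component-isComponent v∈S =
    reach-target ∘ Equivalence.to ∈component⇔ , _ , Equivalence.from ∈component⇔ (here v∈S) , λ _ → ∈component⇔

  module _ {S K : Subset n} (isK : IsComponent G S K) where

    private
      reach-from-root : ∀ {w} → w ∈ K → Reach G S (proj₁ (proj₂ isK)) w
      reach-from-root {w} = Equivalence.to (proj₂ (proj₂ (proj₂ isK)) w)

    component-linked : ∀ {a b} → a ∈ K → b ∈ K → Reach G S a b
    component-linked a∈K b∈K = reach-trans (reach-sym (reach-from-root a∈K)) (reach-from-root b∈K)

    component-closed : ∀ {a b} → a ∈ K → Reach G S a b → b ∈ K
    component-closed {b = b} a∈K r =
      Equivalence.from (proj₂ (proj₂ (proj₂ isK)) b) (reach-trans (reach-from-root a∈K) r)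

    component-connected : Connected G K
    component-connected u w u∈K w∈K =
      reach-within (λ _ r → component-closed u∈K r) (component-linked u∈K w∈K)

    component-reach-avoiding : ∀ {y u w} → y ∉ K → u ∈ K → Reach G S u w → Reach G (∁ ⁅ y ⁆) u w
    component-reach-avoiding y∉K u∈K =
      reach-within λ _ r → x≢y⇒x∈∁⁅y⁆ λ { refl → y∉K (component-closed u∈K r) }

  Simple-⊆ : ∀ {K K′} → K ⊆ K′ → Simple G K′ → Simple G K
  Simple-⊆ K⊆K′ simple u v u∈K v∈K = simple u v (K⊆K′ u∈K) (K⊆K′ v∈K)

  cycle-within : ∀ {S T} (cy : Cycle G S) → (∀ i → Cycle.c cy i ∈ T) → Cycle G T
  cycle-within cy inT = record
    { r = r ; c = c ; inS = inT ; inj = inj ; consec = consec ; close = close }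
    where open Cycle cy

  IsTree-⊆ : ∀ {K K′} → K ⊆ K′ → Connected G K → IsTree G K′ → IsTree G K
  IsTree-⊆ K⊆K′ connected (simple , _ , acyclic) =
    Simple-⊆ K⊆K′ simple , connected , λ cy → acyclic (cycle-within cy (K⊆K′ ∘ Cycle.inS cy))

  ProperInterval-⊆ : ∀ {K K′} → K ⊆ K′ → ProperInterval G K′ → ProperInterval G K
  ProperInterval-⊆ K⊆K′ (l , r , l≤r , adj⇔ , proper) =
    l , r , (λ v v∈K → l≤r v (K⊆K′ v∈K)) ,
    (λ u v u∈K v∈K → adj⇔ u v (K⊆K′ u∈K) (K⊆K′ v∈K)) ,
    (λ u v u∈K v∈K → proper u v (K⊆K′ u∈K) (K⊆K′ v∈K))

  ProperIntervalOrTree : Subset n → Set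
  ProperIntervalOrTree K = ProperInterval G K ⊎ IsTree G K

  ProperIntervalOrTree-⊆ : ∀ {K K′} → K ⊆ K′ → Connected G K → ProperIntervalOrTree K′ → ProperIntervalOrTree K
  ProperIntervalOrTree-⊆ K⊆K′ _         (inj₁ pi)   = inj₁ (ProperInterval-⊆ K⊆K′ pi)
  ProperIntervalOrTree-⊆ K⊆K′ connected (inj₂ tree) = inj₂ (IsTree-⊆ K⊆K′ connected tree)

  ComponentsProperIntervalOrTree : Subset n → Set
  ComponentsProperIntervalOrTree S = ∀ K → IsComponent G S K → ProperIntervalOrTree K

  component-inherits : ∀ {S S₀ K v} → ComponentsProperIntervalOrTree S₀ → IsComponent G S K → v ∈ K →
                       (∀ {w} → Reach G S v w → Reach G S₀ v w) → ProperIntervalOrTree K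
  component-inherits good isK v∈K lift =
    ProperIntervalOrTree-⊆ (Equivalence.from ∈component⇔ ∘ lift ∘ component-linked isK v∈K)
      (component-connected isK)
      (good _ (component-isComponent (reach-source (lift (here (proj₁ isK v∈K))))))

  ComponentsProperIntervalOrTree-⊆ : ∀ {S S₀} → S ⊆ S₀ →
    ComponentsProperIntervalOrTree S₀ → ComponentsProperIntervalOrTree S
  ComponentsProperIntervalOrTree-⊆ S⊆S₀ good K isK@(_ , _ , v∈K , _) =
    component-inherits good isK v∈K (reach-mono S⊆S₀)

  solution-restrict : ∀ {S S′ k X} → S′ ⊆ S → PITVDSolution G S k X → PITVDSolution G S′ k (X ∩ S′)
  solution-restrict {S} {S′} {X = X} S′⊆S (_ , ∣X∣≤k , simple , good) =
    p∩q⊆q X S′ , ℕ.≤-trans (∣p∩q∣≤∣p∣ X S′) ∣X∣≤k ,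
    Simple-⊆ shrink simple , ComponentsProperIntervalOrTree-⊆ shrink good
    where
    shrink : S′ ∩ ∁ (X ∩ S′) ⊆ S ∩ ∁ X
    shrink w∈ = x∈p∩q⁺ (S′⊆S (p∩q⊆p _ _ w∈) ,
      x∉p⇒x∈∁p λ w∈X → x∈∁p⇒x∉p (p∩q⊆q _ _ w∈) (x∈p∩q⁺ (w∈X , p∩q⊆p _ _ w∈)))

  YesInstance-⊆ : ∀ {S S′ k} → S′ ⊆ S → YesInstance G S k → YesInstance G S′ k
  YesInstance-⊆ S′⊆S (X , solution) = X ∩ _ , solution-restrict S′⊆S solution

  Independent : Fin n → Fin n → Set
  Independent u v = u ≢ v × ¬ Adj G u v

  ProperInterval-clawFree : ∀ {K x a b c} → ProperInterval G K → x ∈ K → a ∈ K → b ∈ K → c ∈ K →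
    Adj G x a → Adj G x b → Adj G x c → Independent a b → Independent b c → Independent a c → ⊥
  ProperInterval-clawFree {K} {x} {a} {b} {c} (l , r , _ , adj⇔ , proper) x∈K a∈K b∈K c∈K xa xb xc ab bc ac =
    order (apart a∈K b∈K ab) (apart b∈K c∈K bc) (apart a∈K c∈K ac)
    where
    apart : ∀ {u v} → u ∈ K → v ∈ K → Independent u v → r u < l v ⊎ r v < l u
    apart {u} {v} u∈K v∈K (u≢v , ¬uv) with l u ≤? r v | l v ≤? r u
    ... | yes lu≤rv | yes lv≤ru = ⊥-elim (¬uv (Equivalence.from (adj⇔ u v u∈K v∈K u≢v) (lu≤rv , lv≤ru)))
    ... | no lu≰rv  | _         = inj₂ (ℕ.≰⇒> lu≰rv)
    ... | yes _     | no lv≰ru  = inj₁ (ℕ.≰⇒> lv≰ru)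
    meets : ∀ {u} → u ∈ K → Adj G x u → l x ≤ r u × l u ≤ r x
    meets {u} u∈K xu = Equivalence.to (adj⇔ x u x∈K u∈K λ { refl → Adj-irrefl xu }) xu
    -- x meets the intervals on both sides of v, so its interval properly contains that of v.
    between : ∀ {u v w} → u ∈ K → v ∈ K → w ∈ K → Adj G x u → Adj G x w → r u < l v → r v < l w → ⊥
    between u∈K v∈K w∈K xu xw u<v v<w = proper x _ x∈K v∈K (ℕ.<⇒≤ lx<lv , ℕ.<⇒≤ rv<rx , inj₁ lx<lv)
      where
      lx<lv = ℕ.≤-<-trans (proj₁ (meets u∈K xu)) u<v
      rv<rx = ℕ.<-≤-trans v<w (proj₂ (meets w∈K xw))
    order : r a < l b ⊎ r b < l a → r b < l c ⊎ r c < l b → r a < l c ⊎ r c < l a → ⊥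
    order (inj₁ a<b) (inj₁ b<c) _          = between a∈K b∈K c∈K xa xc a<b b<c
    order (inj₂ b<a) (inj₂ c<b) _          = between c∈K b∈K a∈K xc xa c<b b<a
    order (inj₁ a<b) (inj₂ c<b) (inj₁ a<c) = between a∈K c∈K b∈K xa xb a<c c<b
    order (inj₁ a<b) (inj₂ c<b) (inj₂ c<a) = between c∈K a∈K b∈K xc xb c<a a<b
    order (inj₂ b<a) (inj₁ b<c) (inj₁ a<c) = between b∈K a∈K c∈K xb xc b<a a<c
    order (inj₂ b<a) (inj₁ b<c) (inj₂ c<a) = between b∈K c∈K a∈K xb xa b<c c<a

  module _ {S : Subset n} (cy : Cycle G S) (x : Fin n) where

    open Cycle cy

    private
      inject₁<suc : ∀ {m} (j : Fin m) → inject₁ j Fin.< suc j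
      inject₁<suc j = Fin.≤̄⇒inject₁< ℕ.≤-refl

    cycle-prefix-reach : ∀ j → (∀ t → t Fin.≤ j → c t ≢ x) → Reach G (∁ ⁅ x ⁆) (c zero) (c j)
    cycle-prefix-reach = <-weakInduction P start extend
      where
      P : Fin _ → Set
      P j = (∀ t → t Fin.≤ j → c t ≢ x) → Reach G (∁ ⁅ x ⁆) (c zero) (c j)
      start : P zero
      start avoid = here (x≢y⇒x∈∁⁅y⁆ (avoid zero z≤n))
      extend : ∀ j → P (inject₁ j) → P (suc j)
      extend j ih avoid =
        step (ih λ t t≤j → avoid t (ℕ.≤-trans t≤j (ℕ.<⇒≤ (inject₁<suc j))))
             (consec j) (x≢y⇒x∈∁⁅y⁆ (avoid (suc j) ℕ.≤-refl))

    cycle-suffix-reach : ∀ j → (∀ t → j Fin.≤ t → c t ≢ x) → Reach G (∁ ⁅ x ⁆) (c j) (c (fromℕ _))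
    cycle-suffix-reach = >-weakInduction P finish extend
      where
      P : Fin _ → Set
      P j = (∀ t → j Fin.≤ t → c t ≢ x) → Reach G (∁ ⁅ x ⁆) (c j) (c (fromℕ _))
      finish : P (fromℕ _)
      finish avoid = here (x≢y⇒x∈∁⁅y⁆ (avoid (fromℕ _) ℕ.≤-refl))
      extend : ∀ j → P (suc j) → P (inject₁ j)
      extend j ih avoid =
        reach-cons (x≢y⇒x∈∁⁅y⁆ (avoid (inject₁ j) ℕ.≤-refl)) (consec j)
                   (ih λ t j<t → avoid t (ℕ.<⇒≤ (ℕ.<-≤-trans (inject₁<suc j) j<t)))

    -- x occurs at most once on the cycle, so it cannot lie both before and after j.
    cycle-avoids-one-side : ∀ j → c j ≢ x → (∀ t → t Fin.≤ j → c t ≢ x) ⊎ (∀ t → j Fin.≤ t → c t ≢ x)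
    cycle-avoids-one-side j cj≢x with Fin.any? (λ t → (t Fin.≤? j) ×-dec (c t ≟ x))
    ... | no none = inj₁ λ t t≤j ct≡x → none (t , t≤j , ct≡x)
    ... | yes (s , s≤j , cs≡x) = inj₂ after
      where
      after : ∀ t → j Fin.≤ t → c t ≢ x
      after t j≤t ct≡x with inj (≡.trans ct≡x (≡.sym cs≡x))
      ... | refl = cj≢x (subst (λ u → c u ≡ x) (Fin.≤-antisym s≤j j≤t) cs≡x)

    cycle-minus-vertex-connected : ∃ λ b → c b ≢ x × (∀ j → c j ≢ x → Reach G (∁ ⁅ x ⁆) (c j) (c b))
    cycle-minus-vertex-connected with c zero ≟ x
    ... | no c₀≢x = zero , c₀≢x , λ j cj≢x →
      [ reach-sym ∘ cycle-prefix-reach j , (λ after → step (cycle-suffix-reach j after) close (x≢y⇒x∈∁⁅y⁆ c₀≢x)) ]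
        (cycle-avoids-one-side j cj≢x)
    ... | yes c₀≡x = fromℕ _ , cL≢x , λ j cj≢x →
      [ (λ before → ⊥-elim (before zero z≤n c₀≡x)) , cycle-suffix-reach j ] (cycle-avoids-one-side j cj≢x)
      where
      cL≢x : c (fromℕ _) ≢ x
      cL≢x cL≡x with inj (≡.trans cL≡x (≡.sym c₀≡x))
      ... | ()

module PendantTrees {n ℓ : ℕ} (G : Multigraph n) (x : Fin n) (C : Fin ℓ → Subset n) (ℓ≥3 : 3 ≤ ℓ)
                    (C-injective : Injective _≡_ _≡_ C) (pendant : ∀ j → PendantTree G x (C j)) where

  C-component : ∀ j → IsComponent G (∁ ⁅ x ⁆) (C j)
  C-component j = proj₁ (proj₂ (pendant j))

  C-tree : ∀ j → IsTree G (C j)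
  C-tree j = proj₁ (proj₂ (proj₂ (pendant j)))

  C+x-tree : ∀ j → IsTree G (C j ∪ ⁅ x ⁆)
  C+x-tree j = proj₂ (proj₂ (proj₂ (pendant j)))

  x∉C : ∀ {j} → x ∉ C j
  x∉C {j} x∈C = x∈∁p⇒x∉p (proj₁ (C-component j) x∈C) (x∈⁅x⁆ x)

  C-closed : ∀ {j v w} → v ∈ C j → Reach G (∁ ⁅ x ⁆) v w → w ∈ C j
  C-closed {j} = component-closed G (C-component j)

  C-closed⁻ : ∀ {j v w} → w ∈ C j → Reach G (∁ ⁅ x ⁆) v w → v ∈ C j
  C-closed⁻ w∈C r = C-closed w∈C (reach-sym G r)

  C-neighbour : ∀ {j u v} → u ∈ C j → Adj G u v → v ∈ C j ∪ ⁅ x ⁆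
  C-neighbour {j} {u} {v} u∈C uv with v ≟ x
  ... | yes refl = x∈p∪q⁺ (inj₂ (x∈⁅x⁆ x))
  ... | no v≢x   = x∈p∪q⁺ (inj₁ (C-closed u∈C (step (here (proj₁ (C-component j) u∈C)) uv (x≢y⇒x∈∁⁅y⁆ v≢x))))

  C-simple : ∀ {j u} v → u ∈ C j → mult G u v ≤ 1
  C-simple {j} {u} v u∈C with 0 <? mult G u v
  ... | yes uv = proj₁ (C+x-tree j) u v (x∈p∪q⁺ (inj₁ u∈C)) (C-neighbour u∈C uv)
  ... | no ¬uv = ℕ.≤-trans (ℕ.≮⇒≥ ¬uv) z≤n

  C-disjoint : ∀ {i j v} → v ∈ C i → v ∈ C j → i ≡ j
  C-disjoint {i} {j} v∈Ci v∈Cj = C-injective (⊆-antisym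
    (λ w∈Ci → C-closed v∈Cj (component-linked G (C-component i) v∈Ci w∈Ci))
    (λ w∈Cj → C-closed v∈Ci (component-linked G (C-component j) v∈Cj w∈Cj)))

  C-independent : ∀ {i j a b} → i ≢ j → a ∈ C i → b ∈ C j → Independent G a b
  C-independent {i} {j} i≢j a∈Ci b∈Cj = (λ { refl → i≢j (C-disjoint a∈Ci b∈Cj) }) , nonadjacent
    where
    nonadjacent : ¬ Adj G _ _
    nonadjacent ab with x∈p∪q⁻ (C i) ⁅ x ⁆ (C-neighbour a∈Ci ab)
    ... | inj₁ b∈Ci = i≢j (C-disjoint b∈Ci b∈Cj)
    ... | inj₂ b∈x  = x∉C (subst (_∈ C j) (x∈⁅y⁆⇒x≡y x b∈x) b∈Cj)

  C-reach-x : ∀ {j v} → v ∈ C j → Reach G (C j ∪ ⁅ x ⁆) v x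
  C-reach-x {j} {v} v∈C = proj₁ (proj₂ (C+x-tree j)) v x (x∈p∪q⁺ (inj₁ v∈C)) (x∈p∪q⁺ (inj₂ (x∈⁅x⁆ x)))

  x-neighbour : ∀ j → ∃ λ a → a ∈ C j × Adj G x a
  x-neighbour j with C-component j
  ... | _ , v , v∈C , _ with reach-last-edge G (C-reach-x v∈C) (λ { refl → x∉C v∈C })
  ...   | w , w∈ , wx with x∈p∪q⁻ (C j) ⁅ x ⁆ w∈
  ...     | inj₁ w∈C = w , w∈C , Adj-sym G wx
  ...     | inj₂ w∈x = ⊥-elim (Adj-irrefl G (subst (λ u → Adj G u x) (x∈⁅y⁆⇒x≡y x w∈x) wx))

  InPendant : Fin n → Set
  InPendant v = ∃ λ j → v ∈ C j

  inPendant? : ∀ v → Dec (InPendant v)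
  inPendant? v = Fin.any? λ j → v ∈? C j

  Z : Subset n
  Z = tailUnion C

  ¬InPendant⇒∉Z : ∀ {v} → ¬ InPendant v → v ∉ Z
  ¬InPendant⇒∉Z ¬p v∈Z with ∈tailUnion⁻ C v∈Z
  ... | j , _ , v∈C = ¬p (j , v∈C)

  x∉Z : x ∉ Z
  x∉Z = ¬InPendant⇒∉Z λ { (_ , x∈C) → x∉C x∈C }

  Z-closed : ∀ {v w} → v ∈ Z → Reach G (∁ ⁅ x ⁆) v w → w ∈ Z
  Z-closed v∈Z r with ∈tailUnion⁻ C v∈Z
  ... | j , 3≤j , v∈C = ∈tailUnion⁺ C j 3≤j (C-closed v∈C r)

  C∩Z-empty : ∀ {j a} → toℕ j < 3 → a ∈ C j → a ∉ Z
  C∩Z-empty j<3 a∈Cj a∈Z with ∈tailUnion⁻ C a∈Z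
  ... | i , 3≤i , a∈Ci with C-disjoint a∈Cj a∈Ci
  ...   | refl = ℕ.<⇒≱ j<3 3≤i

  -- A walk from x that enters Z must return to x before leaving it.
  reach-from-x-avoiding-Z : ∀ {S T w} → (∀ {v} → v ∈ S → v ∉ Z → v ∈ T) →
                            Reach G S x w → w ∉ Z → Reach G T x w
  reach-from-x-avoiding-Z S∖Z⊆T (here x∈S) _ = here (S∖Z⊆T x∈S x∉Z)
  reach-from-x-avoiding-Z S∖Z⊆T (step {w = v} r vw w∈S) w∉Z with v ∈? Z
  ... | no v∉Z = step (reach-from-x-avoiding-Z S∖Z⊆T r v∉Z) vw (S∖Z⊆T w∈S w∉Z)
  ... | yes v∈Z with ∈tailUnion⁻ C v∈Z
  ...   | j , 3≤j , v∈C with x∈p∪q⁻ (C j) ⁅ x ⁆ (C-neighbour v∈C vw)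
  ...     | inj₁ w∈C = ⊥-elim (w∉Z (∈tailUnion⁺ C j 3≤j w∈C))
  ...     | inj₂ w∈x with x∈⁅y⁆⇒x≡y x w∈x
  ...       | refl = here (S∖Z⊆T (reach-source G r) x∉Z)

  firstThree : Fin 3 → Fin ℓ
  firstThree t = inject≤ t ℓ≥3

  firstThree<3 : ∀ t → toℕ (firstThree t) < 3
  firstThree<3 t = subst (_< 3) (≡.sym (Fin.toℕ-inject≤ t ℓ≥3)) (Fin.toℕ<n t)

  module _ {k : ℕ} {X : Subset n} (solution : PITVDSolution G (∁ Z) k X) where

    private
      ∣X∣≤k : ∣ X ∣ ≤ k
      ∣X∣≤k = proj₁ (proj₂ solution)

      simple-∁Z : Simple G (∁ Z ∩ ∁ X)
      simple-∁Z = proj₁ (proj₂ (proj₂ solution))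

      components-∁Z : ComponentsProperIntervalOrTree G (∁ Z ∩ ∁ X)
      components-∁Z = proj₂ (proj₂ (proj₂ solution))

    CoversOffPendants : Subset n → Set
    CoversOffPendants X′ = ∀ {v} → v ∉ X′ → ¬ InPendant v → v ∉ X

    covers-self : CoversOffPendants X
    covers-self v∉X _ = v∉X

    ¬InPendant⇒∈∁Z∩∁X : ∀ {X′ v} → CoversOffPendants X′ → v ∈ ⊤ ∩ ∁ X′ → ¬ InPendant v → v ∈ ∁ Z ∩ ∁ X
    ¬InPendant⇒∈∁Z∩∁X covers v∈ ¬p =
      x∈p∩q⁺ (x∉p⇒x∈∁p (¬InPendant⇒∉Z ¬p) , x∉p⇒x∈∁p (covers (x∈∁p⇒x∉p (p∩q⊆q _ _ v∈)) ¬p))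

    simple-if-covers : ∀ {X′} → CoversOffPendants X′ → Simple G (⊤ ∩ ∁ X′)
    simple-if-covers covers u v u∈ v∈ with inPendant? u | inPendant? v
    ... | yes (_ , u∈C) | _             = C-simple v u∈C
    ... | no _          | yes (_ , v∈C) = subst (_≤ 1) (Multigraph.sym G v u) (C-simple u v∈C)
    ... | no ¬u         | no ¬v         =
      simple-∁Z u v (¬InPendant⇒∈∁Z∩∁X covers u∈ ¬u) (¬InPendant⇒∈∁Z∩∁X covers v∈ ¬v)

    component-off-x : ∀ {X′ K} → CoversOffPendants X′ → IsComponent G (⊤ ∩ ∁ X′) K → x ∉ K →
                      ProperIntervalOrTree G K
    component-off-x covers isK@(_ , v , v∈K , _) x∉K with inPendant? v
    ... | yes (j , v∈C) =
      ProperIntervalOrTree-⊆ G (C-closed v∈C ∘ component-reach-avoiding G isK x∉K v∈K ∘ component-linked G isK v∈K)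
        (component-connected G isK) (inj₂ (C-tree j))
    ... | no ¬v = component-inherits G components-∁Z isK v∈K (reach-within G λ w r →
      ¬InPendant⇒∈∁Z∩∁X covers (reach-target G r)
        λ { (j , w∈C) → ¬v (j , C-closed⁻ w∈C (component-reach-avoiding G isK x∉K v∈K r)) })

    solution-containing-x : ∀ {X′} → CoversOffPendants X′ → x ∈ X′ → ∣ X′ ∣ ≤ k → PITVDSolution G ⊤ k X′
    solution-containing-x covers x∈X′ ∣X′∣≤k =
      ⊆⊤ , ∣X′∣≤k , simple-if-covers covers ,
      λ K isK → component-off-x covers isK λ x∈K → x∈∁p⇒x∉p (p∩q⊆q _ _ (proj₁ isK x∈K)) x∈X′

    KeptNeighbourIn : Fin ℓ → Set
    KeptNeighbourIn j = ∃ λ a → a ∈ C j × Adj G x a × a ∉ X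

    keptNeighbourIn? : ∀ j → Dec (KeptNeighbourIn j)
    keptNeighbourIn? j = Fin.any? λ a → (a ∈? C j) ×-dec (adj? G x a ×-dec ¬? (a ∈? X))

    exchange : ∀ j → ¬ KeptNeighbourIn j → YesInstance G ⊤ k
    exchange j none with x-neighbour j
    ... | y , y∈C , xy = X′ , solution-containing-x covers (x∈p∪q⁺ (inj₂ (x∈⁅x⁆ x))) ∣X′∣≤k
      where
      y∈X : y ∈ X
      y∈X = decidable-stable (y ∈? X) λ y∉X → none (y , y∈C , xy , y∉X)
      X′ : Subset n
      X′ = (X - y) ∪ ⁅ x ⁆
      ∣X′∣≤k : ∣ X′ ∣ ≤ k
      ∣X′∣≤k = begin
        ∣ X′ ∣                ≤⟨ ∣p∪q∣≤∣p∣+∣q∣ (X - y) ⁅ x ⁆ ⟩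
        ∣ X - y ∣ + ∣ ⁅ x ⁆ ∣ ≡⟨ cong (∣ X - y ∣ +_) (∣⁅x⁆∣≡1 x) ⟩
        ∣ X - y ∣ + 1         ≡⟨ ℕ.+-comm _ 1 ⟩
        suc ∣ X - y ∣         ≤⟨ x∈p⇒∣p-x∣<∣p∣ y∈X ⟩
        ∣ X ∣                 ≤⟨ ∣X∣≤k ⟩
        k                     ∎
        where open ℕ.≤-Reasoning
      covers : CoversOffPendants X′
      covers v∉X′ ¬p v∈X = v∉X′ (x∈p∪q⁺ (inj₁ (x∈p∧x≢y⇒x∈p-y v∈X λ { refl → ¬p (j , y∈C) })))

    D : Subset n
    D = component G (∁ Z ∩ ∁ X) x

    module _ (x∉X : x ∉ X) where

      x∈∁Z∩∁X : x ∈ ∁ Z ∩ ∁ X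
      x∈∁Z∩∁X = x∈p∩q⁺ (x∉p⇒x∈∁p x∉Z , x∉p⇒x∈∁p x∉X)

      keptNeighbours⇒D-tree : (∀ t → KeptNeighbourIn (firstThree t)) → IsTree G D
      keptNeighbours⇒D-tree nbrs with components-∁Z D (component-isComponent G x∈∁Z∩∁X)
      ... | inj₂ tree = tree
      ... | inj₁ pi = ⊥-elim (ProperInterval-clawFree G pi
              (Equivalence.from (∈component⇔ G) (here x∈∁Z∩∁X)) (leaf∈D (# 0)) (leaf∈D (# 1)) (leaf∈D (# 2))
              (x-leaf (# 0)) (x-leaf (# 1)) (x-leaf (# 2))
              (independent (λ ())) (independent (λ ())) (independent (λ ())))
        where
        leaf : Fin 3 → Fin n
        leaf t = proj₁ (nbrs t)
        leaf∈D : ∀ t → leaf t ∈ D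
        leaf∈D t with nbrs t
        ... | a , a∈C , xa , a∉X = Equivalence.from (∈component⇔ G)
          (step (here x∈∁Z∩∁X) xa (x∈p∩q⁺ (x∉p⇒x∈∁p (C∩Z-empty (firstThree<3 t) a∈C) , x∉p⇒x∈∁p a∉X)))
        x-leaf : ∀ t → Adj G x (leaf t)
        x-leaf t = proj₁ (proj₂ (proj₂ (nbrs t)))
        independent : ∀ {s t} → s ≢ t → Independent G (leaf s) (leaf t)
        independent {s} {t} s≢t = C-independent (s≢t ∘ Fin.inject≤-injective _ _ s t)
          (proj₁ (proj₂ (nbrs s))) (proj₁ (proj₂ (nbrs t)))

      x-component-acyclic : IsTree G D → ∀ {K} → IsComponent G (⊤ ∩ ∁ X) K → x ∈ K → ¬ Cycle G K
      x-component-acyclic D-tree isK x∈K cy with cycle-minus-vertex-connected G cy x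
      ... | b , _ , to-b with Cycle.c cy b ∈? Z
      ...   | yes cb∈Z with ∈tailUnion⁻ C cb∈Z
      ...     | j , _ , cb∈C = proj₂ (proj₂ (C+x-tree j)) (cycle-within G cy on-C+x)
        where
        on-C+x : ∀ i → Cycle.c cy i ∈ C j ∪ ⁅ x ⁆
        on-C+x i with Cycle.c cy i ≟ x
        ... | yes ci≡x = subst (_∈ C j ∪ ⁅ x ⁆) (≡.sym ci≡x) (x∈p∪q⁺ (inj₂ (x∈⁅x⁆ x)))
        ... | no ci≢x  = x∈p∪q⁺ (inj₁ (C-closed⁻ cb∈C (to-b i ci≢x)))
      x-component-acyclic D-tree isK x∈K cy | b , _ , to-b | no cb∉Z =
        proj₂ (proj₂ D-tree) (cycle-within G cy in-D)
        where
        off-Z : ∀ i → Cycle.c cy i ∉ Z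
        off-Z i with Cycle.c cy i ≟ x
        ... | yes ci≡x = subst (_∉ Z) (≡.sym ci≡x) x∉Z
        ... | no ci≢x  = λ ci∈Z → cb∉Z (Z-closed ci∈Z (to-b i ci≢x))
        in-D : ∀ i → Cycle.c cy i ∈ D
        in-D i = Equivalence.from (∈component⇔ G) (reach-from-x-avoiding-Z
          (λ v∈ v∉Z → x∈p∩q⁺ (x∉p⇒x∈∁p v∉Z , p∩q⊆q _ _ v∈))
          (component-linked G isK x∈K (Cycle.inS cy i)) (off-Z i))

      D-tree⇒solution : IsTree G D → PITVDSolution G ⊤ k X
      D-tree⇒solution D-tree = ⊆⊤ , ∣X∣≤k , simple-if-covers covers-self , components
        where
        components : ComponentsProperIntervalOrTree G (⊤ ∩ ∁ X)
        components K isK with x ∈? K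
        ... | no x∉K  = component-off-x covers-self isK x∉K
        ... | yes x∈K = inj₂ (Simple-⊆ G (proj₁ isK) (simple-if-covers covers-self) ,
                              component-connected G isK , x-component-acyclic D-tree isK x∈K)

  backward : ∀ {k} → YesInstance G (∁ Z) k → YesInstance G ⊤ k
  backward (X , solution) with x ∈? X
  ... | yes x∈X = X , solution-containing-x solution (covers-self solution) x∈X (proj₁ (proj₂ solution))
  ... | no x∉X with Fin.all? (keptNeighbourIn? solution ∘ firstThree)
  ...   | yes nbrs = X , D-tree⇒solution solution x∉X (keptNeighbours⇒D-tree solution x∉X nbrs)
  ...   | no ¬nbrs with Fin.¬∀⟶∃¬ 3 _ (keptNeighbourIn? solution ∘ firstThree) ¬nbrs
  ...     | t , none = exchange solution (firstThree t) none

lemma9 : ∀ {n : ℕ} (G : Multigraph n) (k : ℕ) (x : Fin n) (ℓ : ℕ)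
           (C : Fin ℓ → Subset n) →
           4 ≤ ℓ →
           Injective _≡_ _≡_ C →
           (∀ j → PendantTree G x (C j)) →
           YesInstance G ⊤ k ⇔ YesInstance G (∁ (tailUnion C)) k
lemma9 G k x ℓ C 4≤ℓ C-injective pendant =
  mk⇔ (YesInstance-⊆ G ⊆⊤) (PendantTrees.backward G x C (ℕ.<⇒≤ 4≤ℓ) C-injective pendant)
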